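{- Let $G=A+B$ be a finite bipartite graph and let $F$ be a (lexicographically) minimum semi-matching of $B$. Then there exists a maximum matching $M$ of $G$ with $M\subseteq F$.
   Context: $G=A+B$ denotes a bipartite graph with bipartition $(A,B)$; $N(Y)$ is the neighbourhood of $Y$. A semi-matching of $B$ is a set $F\subseteq E(G)$ such that every vertex of $B$ is incident with exactly one edge of $F$. $d_F(v)$ is the number of edges of $F$ incident with $v$; $d_F(B)$ is the sequence of $F$-degrees of the vertices of $N(B)$ in nonincreasing order. A semi-matching $F$ of $B$ is minimum if there is no semi-matching $F'$ of $B$ with $d_{F'}(B)$ lexicographically smaller than $d_F(B)$. A maximum matching of $G$ is a matching of largest cardinality. -}

module Defs where

open import Data.Nat using (ℕ; zero; suc; _+_; _≡ᵇ_; _≤_; _<_)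
open import Data.Nat.Properties using (≤-decTotalOrder)
open import Data.Bool using (Bool; true; false; if_then_else_; not)
open import Data.Fin using (Fin)
open import Data.List using (List; allFin; map; reverse; filterᵇ)
open import Data.Product using (Σ; ∃; _×_; _,_)
open import Relation.Binary.PropositionalEquality using (_≡_)
open import Relation.Nullary using (¬_)
open import Data.List.Relation.Binary.Lex.Strict using (Lex-<)
open import Data.List.Sort ≤-decTotalOrder using (sort)
open import Data.Nat.ListAction using (sum)

-- A finite bipartite graph G = A + B with A = Fin a, B = Fin b.
EdgeSet : ℕ → ℕ → Set
EdgeSet a b = Fin a → Fin b → Bool

record BipGraph : Set where
  field
    a : ℕ
    b : ℕ
    E : EdgeSet a b
open BipGraph public

count : {n : ℕ} → (Fin n → Bool) → ℕ
count {zero}  p = 0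
count {suc n} p = (if p Fin.zero then 1 else 0) + count (λ i → p (Fin.suc i))

_⊆E_ : {a b : ℕ} → EdgeSet a b → EdgeSet a b → Set
F ⊆E H = ∀ x y → F x y ≡ true → H x y ≡ true

IsSemiMatching : (G : BipGraph) → EdgeSet (a G) (b G) → Set
IsSemiMatching G F =
  (F ⊆E E G) ×
  (∀ y → Σ (Fin (a G)) λ x → (F x y ≡ true) × (∀ x' → F x' y ≡ true → x' ≡ x))

degA : {a b : ℕ} → EdgeSet a b → Fin a → ℕ
degA F x = count (λ y → F x y)

degB : {a b : ℕ} → EdgeSet a b → Fin b → ℕ
degB F y = count (λ x → F x y)

inNB : (G : BipGraph) → Fin (a G) → Bool
inNB G x = not (count (E G x) ≡ᵇ 0)

degSeq : (G : BipGraph) → EdgeSet (a G) (b G) → List ℕ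
degSeq G F = reverse (sort (map (degA F) (filterᵇ (inNB G) (allFin (a G)))))

_<lex_ : List ℕ → List ℕ → Set
_<lex_ = Lex-< _≡_ _<_

IsMinSemiMatching : (G : BipGraph) → EdgeSet (a G) (b G) → Set
IsMinSemiMatching G F =
  IsSemiMatching G F ×
  ¬ (Σ (EdgeSet (a G) (b G)) λ F' → IsSemiMatching G F' × (degSeq G F' <lex degSeq G F))

IsMatching : (G : BipGraph) → EdgeSet (a G) (b G) → Set
IsMatching G M =
  (M ⊆E E G) × (∀ x → degA M x ≤ 1) × (∀ y → degB M y ≤ 1)

size : {a b : ℕ} → EdgeSet a b → ℕ
size {a} {b} M = sum (map (degA M) (allFin a))

IsMaxMatching : (G : BipGraph) → EdgeSet (a G) (b G) → Set
IsMaxMatching G M =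
  IsMatching G M × (∀ M' → IsMatching G M' → size M' ≤ size M)

module Submission where

-- Let F be a
-- lexicographically minimum semi-matching of B.  Keeping, for every
-- x ∈ A, only the first F-edge at x gives a matching M ⊆ F whose size is the number of A-vertices covered by F.  So it
-- suffices to show that no matching M' covers more A-vertices than F.
-- We compare degree sequences through their threshold counts
-- ("profile": how many vertices of N(B) have F-degree ≥ t); a strictly
-- smaller profile at the first differing threshold yields a
-- lexicographically smaller degree sequence.  If M' covers more vertices,
-- some x is M'-covered but F-isolated; move the F-edge of an M'-neighbour
-- y of x over to x.  If the old F-partner of y had degree ≥ 2 the profile
-- drops, contradicting minimality; otherwise the two degrees are swapped,
-- the profile is unchanged, and F agrees with M' at one more vertex of B.
-- As agreement is bounded by |B|, the process stops.

open import Defs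
open import Data.Product using (Σ; _×_; _,_; proj₁; proj₂)
import Data.Product as Product
open import Function using (id)
open import Data.Nat using (ℕ; zero; suc; _+_; _≤_; _<_; _≥_; z≤n; s≤s; _≤?_; _<?_)
open import Data.Nat.Properties hiding (_≟_)
open import Data.Bool using (Bool; true; false; if_then_else_; not; _∧_)
open import Data.Bool.Properties using (∧-zeroʳ; ∧-identityʳ)
open import Data.Fin using (Fin; zero; suc; _≟_)
import Data.Fin.Properties as Fin
open import Data.Empty using (⊥-elim)
open import Relation.Nullary using (¬_; does; yes; no)
open import Relation.Nullary.Decidable using (dec-true; dec-false)
open import Relation.Binary.PropositionalEquality
open import Relation.Binary.Definitions using (tri<; tri≈; tri>)
open import Data.List using (List; []; _∷_; map; tabulate; filterᵇ; reverseAcc)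
open import Data.Nat.ListAction using (sum)
open import Data.Nat.ListAction.Properties using (sum-↭)
open import Data.List.Relation.Unary.All using (All; []; _∷_)
import Data.List.Relation.Unary.All as All
open import Data.List.Relation.Unary.AllPairs using (AllPairs; []; _∷_)
open import Data.List.Relation.Unary.Linked.Properties using (Linked⇒AllPairs)
open import Data.List.Relation.Binary.Permutation.Propositional using (↭-trans)
open import Data.List.Relation.Binary.Permutation.Propositional.Properties using (↭-reverse; map⁺)
open import Data.List.Sort ≤-decTotalOrder using (sort-↭; sort-↗)
open import Data.List.Relation.Binary.Lex.Core using (halt; this; next)

bit : Bool → ℕ
bit b = if b then 1 else 0

bit≤1 : ∀ b → bit b ≤ 1
bit≤1 true  = ≤-refl
bit≤1 false = z≤n

positive : ℕ → Bool
positive v = does (1 ≤? v)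

positive-true : ∀ v → positive v ≡ true → 1 ≤ v
positive-true (suc v) _ = s≤s z≤n

positive-false : ∀ v → positive v ≡ false → v ≡ 0
positive-false zero _ = refl

count-cong : ∀ {n} (p q : Fin n → Bool) → (∀ i → p i ≡ q i) → count p ≡ count q
count-cong {zero}  p q eq = refl
count-cong {suc n} p q eq =
  cong₂ _+_ (cong bit (eq zero)) (count-cong (λ i → p (suc i)) (λ i → q (suc i)) (λ i → eq (suc i)))

count-none : ∀ {n} → count {n} (λ _ → false) ≡ 0
count-none {zero}  = refl
count-none {suc n} = count-none {n}

count-≤ : ∀ {n} (p : Fin n → Bool) → count p ≤ n
count-≤ {zero}  p = z≤n
count-≤ {suc n} p = +-mono-≤ (bit≤1 (p zero)) (count-≤ (λ i → p (suc i)))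

count-mono : ∀ {n} (p q : Fin n → Bool) → (∀ i → p i ≡ true → q i ≡ true) → count p ≤ count q
count-mono {zero}  p q p⇒q = z≤n
count-mono {suc n} p q p⇒q =
  +-mono-≤ (bit-mono (p zero) (q zero) (p⇒q zero))
           (count-mono (λ i → p (suc i)) (λ i → q (suc i)) (λ i → p⇒q (suc i)))
  where
  bit-mono : ∀ u v → (u ≡ true → v ≡ true) → bit u ≤ bit v
  bit-mono false v _   = z≤n
  bit-mono true  v u⇒v rewrite u⇒v refl = ≤-refl

count-pos : ∀ {n} (p : Fin n → Bool) i → p i ≡ true → 1 ≤ count p
count-pos p zero    pi rewrite pi = s≤s z≤n
count-pos p (suc i) pi = ≤-trans (count-pos (λ j → p (suc j)) i pi) (m≤n+m _ (bit (p zero)))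

count-zero⇒false : ∀ {n} (p : Fin n → Bool) i → count p ≡ 0 → p i ≡ false
count-zero⇒false p i c with p i in pi
... | false = refl
... | true  = ⊥-elim (1+n≰n (subst (1 ≤_) c (count-pos p i pi)))

count-wit : ∀ {n} (p : Fin n → Bool) → 1 ≤ count p → Σ (Fin n) λ i → p i ≡ true
count-wit {suc n} p pos with p zero in p0
... | true  = zero , p0
... | false with count-wit (λ i → p (suc i)) pos
...   | i , pi = suc i , pi

count-two : ∀ {n} (p : Fin n → Bool) i j → i ≢ j → p i ≡ true → p j ≡ true → 2 ≤ count p
count-two p zero    zero    i≢j _  _  = ⊥-elim (i≢j refl)
count-two p zero    (suc j) _   pi pj rewrite pi = s≤s (count-pos (λ k → p (suc k)) j pj)
count-two p (suc i) zero    _   pi pj rewrite pj = s≤s (count-pos (λ k → p (suc k)) i pi)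
count-two p (suc i) (suc j) i≢j pi pj =
  ≤-trans (count-two (λ k → p (suc k)) i j (λ i≡j → i≢j (cong suc i≡j)) pi pj) (m≤n+m _ (bit (p zero)))

count-excess : ∀ {n} (p q : Fin n → Bool) → count q < count p → Σ (Fin n) λ i → (p i ≡ true) × (q i ≡ false)
count-excess {suc n} p q lt with p zero in p0 | q zero in q0
... | true  | false = zero , p0 , q0
... | true  | true  = Product.map suc id (count-excess (λ i → p (suc i)) (λ i → q (suc i)) (+-cancelˡ-< 1 _ _ lt))
... | false | true  = Product.map suc id (count-excess (λ i → p (suc i)) (λ i → q (suc i)) (<-trans (n<1+n _) lt))
... | false | false = Product.map suc id (count-excess (λ i → p (suc i)) (λ i → q (suc i)) lt)

count-point : ∀ {n} (p q : Fin n → Bool) j → (∀ i → i ≢ j → p i ≡ q i) →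
  count p + bit (q j) ≡ count q + bit (p j)
count-point {suc n} p q zero off
  rewrite count-cong (λ i → p (suc i)) (λ i → q (suc i)) (λ i → off (suc i) (λ ()))
  = rearrange (bit (p zero)) _ (bit (q zero))
  where
  rearrange : ∀ u c v → u + c + v ≡ v + c + u
  rearrange u c v = trans (+-comm (u + c) v) (trans (cong (v +_) (+-comm u c)) (sym (+-assoc v c u)))
count-point {suc n} p q (suc j) off rewrite off zero (λ ()) =
  trans (+-assoc (bit (q zero)) _ _)
    (trans (cong (bit (q zero) +_)
             (count-point (λ i → p (suc i)) (λ i → q (suc i)) j (λ i i≢j → off (suc i) (λ e → i≢j (Fin.suc-injective e)))))
           (sym (+-assoc (bit (q zero)) _ _)))

count-flip : ∀ {n} (p q : Fin n → Bool) j → (∀ i → i ≢ j → p i ≡ q i) →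
  p j ≡ true → q j ≡ false → count p ≡ suc (count q)
count-flip p q j off pj qj = begin
  count p                ≡⟨ sym (+-identityʳ _) ⟩
  count p + bit false    ≡⟨ cong (λ v → count p + bit v) (sym qj) ⟩
  count p + bit (q j)    ≡⟨ count-point p q j off ⟩
  count q + bit (p j)    ≡⟨ cong (λ v → count q + bit v) pj ⟩
  count q + 1            ≡⟨ +-comm _ 1 ⟩
  suc (count q)          ∎
  where open ≡-Reasoning

count-one : ∀ {n} (p : Fin n → Bool) j → p j ≡ true → (∀ i → p i ≡ true → i ≡ j) → count p ≡ 1
count-one {n} p j pj unique = trans (count-flip p (λ _ → false) j off pj refl) (cong suc (count-none {n}))
  where
  off : ∀ i → i ≢ j → p i ≡ false
  off i i≢j with p i in pi
  ... | true  = ⊥-elim (i≢j (unique i pi))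
  ... | false = refl

count-swap : ∀ {n} (p q : Fin n → Bool) i j → i ≢ j → (∀ z → z ≢ i → z ≢ j → p z ≡ q z) →
  p i ≡ q j → p j ≡ q i → count p ≡ count q
count-swap p q i j i≢j off pi pj = +-cancelʳ-≡ _ _ _ (begin
    count p + bit (q i) ≡⟨ cong (λ v → count p + bit v) (sym ri) ⟩
    count p + bit (r i) ≡⟨ count-point p r i p≡r ⟩
    count r + bit (p i) ≡⟨ cong (λ v → count r + bit v) pi ⟩
    count r + bit (q j) ≡⟨ count-point r q j r≡q ⟩
    count q + bit (r j) ≡⟨ cong (λ v → count q + bit v) (trans rj pj) ⟩
    count q + bit (q i) ∎)
  where
  open ≡-Reasoning
  r : _ → Bool
  r z = if does (z ≟ i) then q i else p z
  ri : r i ≡ q i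
  ri rewrite dec-true (i ≟ i) refl = refl
  rj : r j ≡ p j
  rj rewrite dec-false (j ≟ i) (λ e → i≢j (sym e)) = refl
  p≡r : ∀ z → z ≢ i → p z ≡ r z
  p≡r z z≢i rewrite dec-false (z ≟ i) z≢i = refl
  r≡q : ∀ z → z ≢ j → r z ≡ q z
  r≡q z z≢j with z ≟ i
  ... | yes refl = refl
  ... | no z≢i  = off z z≢i z≢j

sumF : ∀ {n} → (Fin n → ℕ) → ℕ
sumF {zero}  f = 0
sumF {suc n} f = f zero + sumF (λ i → f (suc i))

sumF-mono : ∀ {n} (f g : Fin n → ℕ) → (∀ i → f i ≤ g i) → sumF f ≤ sumF g
sumF-mono {zero}  f g f≤g = z≤n
sumF-mono {suc n} f g f≤g = +-mono-≤ (f≤g zero) (sumF-mono (λ i → f (suc i)) (λ i → g (suc i)) (λ i → f≤g (suc i)))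

sumF-cong : ∀ {n} (f g : Fin n → ℕ) → (∀ i → f i ≡ g i) → sumF f ≡ sumF g
sumF-cong {zero}  f g f≡g = refl
sumF-cong {suc n} f g f≡g = cong₂ _+_ (f≡g zero) (sumF-cong (λ i → f (suc i)) (λ i → g (suc i)) (λ i → f≡g (suc i)))

count≡sumF : ∀ {n} (p : Fin n → Bool) → count p ≡ sumF (λ i → bit (p i))
count≡sumF {zero}  p = refl
count≡sumF {suc n} p = cong (bit (p zero) +_) (count≡sumF (λ i → p (suc i)))

sum-tabulate : ∀ {n} {A : Set} (f : Fin n → A) (h : A → ℕ) → sum (map h (tabulate f)) ≡ sumF (λ i → h (f i))
sum-tabulate {zero}  f h = refl
sum-tabulate {suc n} f h = cong (h (f zero) +_) (sum-tabulate (λ i → f (suc i)) h)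

size≡sumF : ∀ {a b} (M : EdgeSet a b) → size M ≡ sumF (degA M)
size≡sumF M = sum-tabulate (λ i → i) (degA M)

atLeast : ℕ → ℕ → ℕ
atLeast t v = bit (does (t ≤? v))

countAtLeast : ℕ → List ℕ → ℕ
countAtLeast t xs = sum (map (atLeast t) xs)

countAtLeast-head : ∀ t xs → 1 ≤ countAtLeast t (t ∷ xs)
countAtLeast-head t xs rewrite dec-true (t ≤? t) ≤-refl = s≤s z≤n

countAtLeast-zero : ∀ t xs → All (_< t) xs → countAtLeast t xs ≡ 0
countAtLeast-zero t []       []            = refl
countAtLeast-zero t (x ∷ xs) (x<t ∷ xs<t)
  rewrite dec-false (t ≤? x) (<⇒≱ x<t) = countAtLeast-zero t xs xs<t

below-head : ∀ {h t} (T : List ℕ) → All (h ≥_) T → h < t → All (_< t) (h ∷ T)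
below-head T h≥T h<t = h<t ∷ All.map (λ x≤h → ≤-<-trans x≤h h<t) h≥T

lex-from-thresholds : ∀ d (L' L : List ℕ) → AllPairs _≥_ L' → AllPairs _≥_ L →
  (∀ t → d < t → countAtLeast t L' ≡ countAtLeast t L) →
  countAtLeast d L' < countAtLeast d L → L' <lex L
lex-from-thresholds d []        []      _ _ _ ()
lex-from-thresholds d []        (_ ∷ _) _ _ _ _ = halt
lex-from-thresholds d (_ ∷ _)   []      _ _ _ ()
lex-from-thresholds d (h' ∷ T') (h ∷ T) (_ ∷ sorted') (h≥T ∷ sorted) above at with <-cmp h' h
... | tri< h'<h _ _ = this h'<h
... | tri≈ _ refl _ =
  next refl (lex-from-thresholds d T' T sorted' sorted
              (λ t d<t → +-cancelˡ-≡ (atLeast t h) _ _ (above t d<t)) (+-cancelˡ-< (atLeast d h) _ _ at))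
... | tri> _ _ h<h' with d <? h'
...   | yes d<h' = ⊥-elim (n≮0 (≤-trans (countAtLeast-head h' T')
                     (≤-reflexive (trans (above h' d<h') (countAtLeast-zero h' (h ∷ T) (below-head T h≥T h<h'))))))
...   | no d≮h' = ⊥-elim (n≮0 (<-≤-trans at
                     (≤-reflexive (countAtLeast-zero d (h ∷ T) (below-head T h≥T (<-≤-trans h<h' (≮⇒≥ d≮h')))))))

reverse-nonincreasing : ∀ (acc xs : List ℕ) → AllPairs _≥_ acc → AllPairs _≤_ xs →
  All (λ z → All (z ≤_) xs) acc → AllPairs _≥_ (reverseAcc acc xs)
reverse-nonincreasing acc []       acc↘ _          _ = acc↘
reverse-nonincreasing acc (x ∷ xs) acc↘ (x≤xs ∷ xs↗) acc≤ =
  reverse-nonincreasing (x ∷ acc) xs (All.map All.head acc≤ ∷ acc↘) xs↗ (x≤xs ∷ All.map All.tail acc≤)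

profile : (G : BipGraph) → EdgeSet (a G) (b G) → ℕ → ℕ
profile G F t = count (λ x → inNB G x ∧ does (t ≤? degA F x))

countAtLeast-degSeq : ∀ G F t → countAtLeast t (degSeq G F) ≡ profile G F t
countAtLeast-degSeq G F t =
  trans (sum-↭ (map⁺ (atLeast t) (↭-trans (↭-reverse _) (sort-↭ _))))
        (filtered (λ i → i) (inNB G) (degA F))
  where
  filtered : ∀ {n} {A : Set} (f : Fin n → A) (p : A → Bool) (h : A → ℕ) →
    countAtLeast t (map h (filterᵇ p (tabulate f))) ≡ count (λ i → p (f i) ∧ does (t ≤? h (f i)))
  filtered {zero}  f p h = refl
  filtered {suc n} f p h with p (f zero)
  ... | true  = cong (atLeast t (h (f zero)) +_) (filtered (λ i → f (suc i)) p h)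
  ... | false = filtered (λ i → f (suc i)) p h

degSeq-nonincreasing : ∀ G F → AllPairs _≥_ (degSeq G F)
degSeq-nonincreasing G F = reverse-nonincreasing [] _ [] (Linked⇒AllPairs ≤-trans (sort-↗ _)) []

module _ (G : BipGraph) where

  LowerAt : EdgeSet (a G) (b G) → EdgeSet (a G) (b G) → ℕ → Set
  LowerAt F' F d = (∀ t → d < t → profile G F' t ≡ profile G F t) × profile G F' d < profile G F d

  ProfileMinimal : EdgeSet (a G) (b G) → Set
  ProfileMinimal F = ∀ F' d → IsSemiMatching G F' → ¬ LowerAt F' F d

  SameProfile : EdgeSet (a G) (b G) → EdgeSet (a G) (b G) → Set
  SameProfile F' F = ∀ t → profile G F' t ≡ profile G F t

  lowerAt⇒lex : ∀ F' F d → LowerAt F' F d → degSeq G F' <lex degSeq G F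
  lowerAt⇒lex F' F d (above , at) =
    lex-from-thresholds d (degSeq G F') (degSeq G F) (degSeq-nonincreasing G F') (degSeq-nonincreasing G F)
      (λ t d<t → trans (countAtLeast-degSeq G F' t) (trans (above t d<t) (sym (countAtLeast-degSeq G F t))))
      (subst₂ _<_ (sym (countAtLeast-degSeq G F' d)) (sym (countAtLeast-degSeq G F d)) at)

  min⇒profileMinimal : ∀ F → IsMinSemiMatching G F → ProfileMinimal F
  min⇒profileMinimal F (_ , minimal) F' d sm' lower = minimal (F' , sm' , lowerAt⇒lex F' F d lower)

  profileMinimal-same : ∀ F F' → ProfileMinimal F → SameProfile F' F → ProfileMinimal F'
  profileMinimal-same F F' minimal same F'' d sm'' (above , at) =
    minimal F'' d sm'' ((λ t d<t → trans (above t d<t) (same t)) , subst (profile G F'' d <_) (same d) at)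

  profile-drop : ∀ F F' x x₁ → inNB G x₁ ≡ true →
    (∀ z → z ≢ x → z ≢ x₁ → degA F' z ≡ degA F z) →
    degA F' x < degA F x₁ → degA F x < degA F x₁ → suc (degA F' x₁) ≡ degA F x₁ →
    LowerAt F' F (degA F x₁)
  profile-drop F F' x x₁ x₁∈NB others F'x<d Fx<d dropped = above , at
    where
    d = degA F x₁
    agree : ∀ t → degA F' x < t → degA F x < t → ∀ z → z ≢ x₁ →
      inNB G z ∧ does (t ≤? degA F' z) ≡ inNB G z ∧ does (t ≤? degA F z)
    agree t F'x<t Fx<t z z≢x₁ with z ≟ x
    ... | yes refl = cong (inNB G z ∧_) (trans (dec-false (t ≤? _) (<⇒≱ F'x<t)) (sym (dec-false (t ≤? _) (<⇒≱ Fx<t))))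
    ... | no z≢x  = cong (λ v → inNB G z ∧ does (t ≤? v)) (others z z≢x z≢x₁)
    above : ∀ t → d < t → profile G F' t ≡ profile G F t
    above t d<t = count-cong _ _ pointwise
      where
      pointwise : ∀ z → inNB G z ∧ does (t ≤? degA F' z) ≡ inNB G z ∧ does (t ≤? degA F z)
      pointwise z with z ≟ x₁
      ... | yes refl = cong (inNB G z ∧_)
            (trans (dec-false (t ≤? _) (<⇒≱ (<-trans (≤-reflexive dropped) d<t))) (sym (dec-false (t ≤? d) (<⇒≱ d<t))))
      ... | no z≢x₁ = agree t (<-trans F'x<d d<t) (<-trans Fx<d d<t) z z≢x₁
    at : profile G F' d < profile G F d
    at = ≤-reflexive (sym (count-flip _ _ x₁ (λ z z≢x₁ → sym (agree d F'x<d Fx<d z z≢x₁))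
           (cong₂ _∧_ x₁∈NB (dec-true (d ≤? d) ≤-refl))
           (trans (cong (_∧ does (d ≤? degA F' x₁)) x₁∈NB) (dec-false (d ≤? _) (<⇒≱ (≤-reflexive dropped))))))

  profile-swap : ∀ F F' x x₁ → x ≢ x₁ →
    (∀ z → z ≢ x → z ≢ x₁ → degA F' z ≡ degA F z) → inNB G x ≡ inNB G x₁ →
    degA F' x ≡ degA F x₁ → degA F' x₁ ≡ degA F x → SameProfile F' F
  profile-swap F F' x x₁ x≢x₁ others x~x₁ deg-x deg-x₁ t =
    count-swap _ _ x x₁ x≢x₁
      (λ z z≢x z≢x₁ → cong (λ v → inNB G z ∧ does (t ≤? v)) (others z z≢x z≢x₁))
      (cong₂ (λ u v → u ∧ does (t ≤? v)) x~x₁ deg-x)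
      (cong₂ (λ u v → u ∧ does (t ≤? v)) (sym x~x₁) deg-x₁)

reassign : ∀ {a b} → EdgeSet a b → Fin b → Fin a → EdgeSet a b
reassign F y x x' y' = if does (y' ≟ y) then does (x' ≟ x) else F x' y'

inNB-true : ∀ G x y → E G x y ≡ true → inNB G x ≡ true
inNB-true G x y exy with count (E G x) | count-pos (E G x) y exy
... | suc _ | _ = refl

reassign-semi : ∀ G F y x → IsSemiMatching G F → E G x y ≡ true → IsSemiMatching G (reassign F y x)
reassign-semi G F y x (F⊆E , partner) exy = ⊆E , partner'
  where
  ⊆E : reassign F y x ⊆E E G
  ⊆E x' y' e with y' ≟ y | x' ≟ x
  ... | yes refl | yes refl = exy
  ... | no _     | _        = F⊆E x' y' e
  partner' : ∀ y' → Σ (Fin (a G)) λ z → (reassign F y x z y' ≡ true) × (∀ x' → reassign F y x x' y' ≡ true → x' ≡ z)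
  partner' y' with y' ≟ y
  ... | yes _ = x , dec-true (x ≟ x) refl , only-x
    where
    only-x : ∀ x' → does (x' ≟ x) ≡ true → x' ≡ x
    only-x x' e with x' ≟ x
    ... | yes x'≡x = x'≡x
  ... | no _  = partner y'

module Reassignment (G : BipGraph) (F : EdgeSet (a G) (b G)) (sm : IsSemiMatching G F)
                    (x : Fin (a G)) (y : Fin (b G)) (exy : E G x y ≡ true) (Fxy : F x y ≡ false) where

  F' : EdgeSet (a G) (b G)
  F' = reassign F y x

  F'-semi : IsSemiMatching G F'
  F'-semi = reassign-semi G F y x sm exy

  partner : Fin (a G)
  partner = proj₁ (proj₂ sm y)

  partner-edge : F partner y ≡ true
  partner-edge = proj₁ (proj₂ (proj₂ sm y))

  partner-unique : ∀ z → F z y ≡ true → z ≡ partner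
  partner-unique = proj₂ (proj₂ (proj₂ sm y))

  x≢partner : x ≢ partner
  x≢partner refl with trans (sym Fxy) partner-edge
  ... | ()

  F'-column : ∀ z → F' z y ≡ does (z ≟ x)
  F'-column z rewrite dec-true (y ≟ y) refl = refl

  F'-off : ∀ z y' → y' ≢ y → F' z y' ≡ F z y'
  F'-off z y' y'≢y rewrite dec-false (y' ≟ y) y'≢y = refl

  degree-x : degA F' x ≡ suc (degA F x)
  degree-x = count-flip (F' x) (F x) y (λ y' → F'-off x y')
               (trans (F'-column x) (dec-true (x ≟ x) refl)) Fxy

  degree-partner : suc (degA F' partner) ≡ degA F partner
  degree-partner = sym (count-flip (F partner) (F' partner) y (λ y' y'≢y → sym (F'-off partner y' y'≢y))
                     partner-edge (trans (F'-column partner) (dec-false (partner ≟ x) (λ e → x≢partner (sym e)))))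

  degree-other : ∀ z → z ≢ x → z ≢ partner → degA F' z ≡ degA F z
  degree-other z z≢x z≢partner = count-cong (F' z) (F z) pointwise
    where
    pointwise : ∀ y' → F' z y' ≡ F z y'
    pointwise y' with y' ≟ y
    ... | no _     = refl
    ... | yes refl with F z y' in Fzy
    ...   | true  = ⊥-elim (z≢partner (partner-unique z Fzy))
    ...   | false = dec-false (z ≟ x) z≢x

covered : ∀ {a b} → EdgeSet a b → Fin a → Bool
covered F x = positive (degA F x)

-- For F ⊆ E(G), covered vertices lie in N(B), so they are counted by the profile at 1.
covered-profile : ∀ G F → F ⊆E E G → count (covered F) ≡ profile G F 1
covered-profile G F F⊆E = count-cong _ _ pointwise
  where
  pointwise : ∀ x → covered F x ≡ inNB G x ∧ covered F x
  pointwise x with covered F x in cov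
  ... | false = sym (∧-zeroʳ (inNB G x))
  ... | true with count-wit (F x) (positive-true _ cov)
  ...   | y , Fxy = sym (trans (∧-identityʳ _) (inNB-true G x y (F⊆E x y Fxy)))

matching-column-unique : ∀ G M → IsMatching G M → ∀ {x x' y} → M x y ≡ true → M x' y ≡ true → x ≡ x'
matching-column-unique G M (_ , _ , degB≤1) {x} {x'} {y} Mxy Mx'y with x ≟ x'
... | yes x≡x' = x≡x'
... | no x≢x'  = ⊥-elim (1+n≰n (≤-trans (count-two (λ z → M z y) x x' x≢x' Mxy Mx'y) (degB≤1 y)))

module WithMatching (G : BipGraph) (M : EdgeSet (a G) (b G)) (isM : IsMatching G M) where

  agrees : EdgeSet (a G) (b G) → Fin (b G) → Bool
  agrees F y = positive (count (λ x → M x y ∧ F x y))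

  agreement : EdgeSet (a G) (b G) → ℕ
  agreement F = count (agrees F)

  exchange : ∀ F → IsSemiMatching G F → ProfileMinimal G F → ∀ x y → degA F x ≡ 0 → M x y ≡ true →
    Σ (EdgeSet (a G) (b G)) λ F' → IsSemiMatching G F' × SameProfile G F' F × (agreement F' ≡ suc (agreement F))
  exchange F sm minimal x y deg-x Mxy = F' , F'-semi , same , more-agreement
    where
    exy : E G x y ≡ true
    exy = proj₁ isM x y Mxy
    open Reassignment G F sm x y exy (count-zero⇒false (F x) y deg-x)

    partner∈NB : inNB G partner ≡ true
    partner∈NB = inNB-true G partner y (proj₁ sm partner y partner-edge)

    degree-x≡1 : degA F' x ≡ 1
    degree-x≡1 = trans degree-x (cong suc deg-x)

    -- the partner had degree one, otherwise the reassignment lowers the profile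
    partner-degree : degA F partner ≡ 1
    partner-degree with 2 ≤? degA F partner
    ... | no  2≰d = ≤-antisym (≤-pred (≰⇒> 2≰d)) (count-pos (F partner) y partner-edge)
    ... | yes 2≤d = ⊥-elim (minimal F' (degA F partner) F'-semi
          (profile-drop G F F' x partner partner∈NB degree-other
            (subst (_< degA F partner) (sym degree-x≡1) 2≤d)
            (subst (_< degA F partner) (sym deg-x) (≤-trans (s≤s z≤n) 2≤d))
            degree-partner))

    same : SameProfile G F' F
    same = profile-swap G F F' x partner x≢partner degree-other
             (trans (inNB-true G x y exy) (sym partner∈NB))
             (trans degree-x≡1 (sym partner-degree))
             (trans (suc-injective (trans degree-partner partner-degree)) (sym deg-x))

    -- before the move y's F-edge ends at the partner, which is not an M-neighbour of y
    agrees-before : agrees F y ≡ false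
    agrees-before = cong positive (trans (count-cong _ _ disjoint) (count-none {a G}))
      where
      disjoint : ∀ z → M z y ∧ F z y ≡ false
      disjoint z with F z y in Fzy
      ... | false = ∧-zeroʳ (M z y)
      ... | true with M z y in Mzy
      ...   | false = refl
      ...   | true  = ⊥-elim (x≢partner (trans (matching-column-unique G M isM Mxy Mzy) (partner-unique z Fzy)))

    agrees-after : agrees F' y ≡ true
    agrees-after = dec-true (1 ≤? _)
      (count-pos (λ z → M z y ∧ F' z y) x (cong₂ _∧_ Mxy (trans (F'-column x) (dec-true (x ≟ x) refl))))

    agrees-off : ∀ y' → y' ≢ y → agrees F' y' ≡ agrees F y'
    agrees-off y' y'≢y = cong positive (count-cong _ _ (λ z → cong (M z y' ∧_) (F'-off z y' y'≢y)))

    more-agreement : agreement F' ≡ suc (agreement F)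
    more-agreement = count-flip (agrees F') (agrees F) y agrees-off agrees-after agrees-before

  -- Iterating the exchange, with fuel n bounding the remaining agreement.
  cover-bound : ∀ n F → IsSemiMatching G F → ProfileMinimal G F → b G ≤ n + agreement F →
    count (covered M) ≤ count (covered F)
  cover-bound n F sm minimal fuel with count (covered M) ≤? count (covered F)
  ... | yes bound = bound
  ... | no  unbounded with count-excess (covered M) (covered F) (≰⇒> unbounded)
  ...   | x , Mcov , Funcov with count-wit (M x) (positive-true _ Mcov)
  ...     | y , Mxy with exchange F sm minimal x y (positive-false _ Funcov) Mxy
  ...       | F' , sm' , same , grows = continue n fuel
    where
    continue : ∀ n → b G ≤ n + agreement F → count (covered M) ≤ count (covered F)
    continue zero    fuel = ⊥-elim (1+n≰n (≤-trans (≤-reflexive (sym grows)) (≤-trans (count-≤ (agrees F')) fuel)))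
    continue (suc n) fuel = begin
      count (covered M)  ≤⟨ cover-bound n F' sm' (profileMinimal-same G F F' minimal same)
                               (≤-trans fuel (≤-reflexive (sym (trans (cong (n +_) grows) (+-suc n _))))) ⟩
      count (covered F') ≡⟨ covered-profile G F' (proj₁ sm') ⟩
      profile G F' 1     ≡⟨ same 1 ⟩
      profile G F 1      ≡⟨ sym (covered-profile G F (proj₁ sm)) ⟩
      count (covered F)  ∎
      where open ≤-Reasoning

  covered-bound : ∀ F → IsSemiMatching G F → ProfileMinimal G F → count (covered M) ≤ count (covered F)
  covered-bound F sm minimal = cover-bound (b G) F sm minimal (m≤m+n (b G) _)

  matching-size : size M ≤ count (covered M)
  matching-size = begin
    size M                            ≡⟨ size≡sumF M ⟩
    sumF (degA M)                     ≤⟨ sumF-mono _ _ (λ x → at-most-one (degA M x) (proj₁ (proj₂ isM) x)) ⟩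
    sumF (λ x → bit (covered M x))    ≡⟨ sym (count≡sumF (covered M)) ⟩
    count (covered M)                 ∎
    where
    open ≤-Reasoning
    at-most-one : ∀ v → v ≤ 1 → v ≤ bit (positive v)
    at-most-one zero          _ = z≤n
    at-most-one (suc zero)    _ = ≤-refl
    at-most-one (suc (suc v)) (s≤s ())

first : ∀ {n} → (Fin n → Bool) → Fin n → Bool
first p zero    = p zero
first p (suc i) = not (p zero) ∧ first (λ j → p (suc j)) i

first-sub : ∀ {n} (p : Fin n → Bool) i → first p i ≡ true → p i ≡ true
first-sub p zero    e = e
first-sub p (suc i) e with p zero
... | false = first-sub (λ j → p (suc j)) i e

count-first : ∀ {n} (p : Fin n → Bool) → count (first p) ≡ bit (positive (count p))
count-first {zero}  p = refl
count-first {suc n} p with p zero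
... | true  = cong suc (count-none {n})
... | false = count-first (λ j → p (suc j))

firstEdges : ∀ {a b} → EdgeSet a b → EdgeSet a b
firstEdges F x = first (F x)

firstEdges⊆ : ∀ {a b} (F : EdgeSet a b) → firstEdges F ⊆E F
firstEdges⊆ F x = first-sub (F x)

size-firstEdges : ∀ {a b} (F : EdgeSet a b) → size (firstEdges F) ≡ count (covered F)
size-firstEdges F = begin
  size (firstEdges F)              ≡⟨ size≡sumF (firstEdges F) ⟩
  sumF (λ x → count (first (F x))) ≡⟨ sumF-cong _ _ (λ x → count-first (F x)) ⟩
  sumF (λ x → bit (covered F x))   ≡⟨ sym (count≡sumF (covered F)) ⟩
  count (covered F)                ∎
  where open ≡-Reasoning

firstEdges-matching : ∀ G F → IsSemiMatching G F → IsMatching G (firstEdges F)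
firstEdges-matching G F (F⊆E , partner) =
  (λ x y e → F⊆E x y (firstEdges⊆ F x y e)) ,
  (λ x → ≤-trans (≤-reflexive (count-first (F x))) (bit≤1 _)) ,
  (λ y → ≤-trans (count-mono _ _ (λ x e → firstEdges⊆ F x y e))
           (≤-reflexive (count-one (λ x → F x y) (proj₁ (partner y)) (proj₁ (proj₂ (partner y))) (proj₂ (proj₂ (partner y))))))

corollary2p16 : (G : BipGraph) (F : EdgeSet (a G) (b G)) →
    IsMinSemiMatching G F →
    Σ (EdgeSet (a G) (b G)) λ M → IsMaxMatching G M × (M ⊆E F)
corollary2p16 G F min = firstEdges F , (firstEdges-matching G F sm , maximum) , firstEdges⊆ F
  where
  sm = proj₁ min
  maximum : ∀ M' → IsMatching G M' → size M' ≤ size (firstEdges F)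
  maximum M' isM' = begin
    size M'               ≤⟨ matching-size ⟩
    count (covered M')    ≤⟨ covered-bound F sm (min⇒profileMinimal G F min) ⟩
    count (covered F)     ≡⟨ sym (size-firstEdges F) ⟩
    size (firstEdges F)   ∎
    where
    open ≤-Reasoning
    open WithMatching G M' isM'
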